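{- Let $c$ be a well-formed GCL command with $\mathsf{ok}(c)$, let $f\notin\mathsf{labs}(c)$, and let $n=\mathsf{lab}(c)$. Then for all stores $s,t$: $(s,t)\in[\![c]\!]$ iff $(n,s)\Rightarrow^*(f,t)$ in $\mathsf{aut}(c,f)$. Consequently, for all sets of stores $P,Q$, $\models c:\{P\}\{Q\}$ iff $\mathsf{aut}(c,f)\models\{P\}\{Q\}$; and for all store relations $\mathcal{Q},\mathcal{S}$ and every well-formed $c'$ with $\mathsf{ok}(c')$ and $f'\notin\mathsf{labs}(c')$, $\models c\mid c':\langle\mathcal{Q}\rangle\langle\mathcal{S}\rangle$ iff $\mathsf{aut}(c,f),\mathsf{aut}(c',f')\models\langle\mathcal{Q}\rangle\langle\mathcal{S}\rangle$.
   Context: Stores are total maps from integer variables to $\mathbb{Z}$. GCL commands: $c ::= \mathsf{skip}^n \mid x :=^n e \mid c;c \mid \mathsf{if}^n\, gcs\,\mathsf{fi} \mid \mathsf{do}^n\, gcs\,\mathsf{od}$, $gcs ::= e\to c \mid e\to c \,\square\, gcs$, $n\in\mathbb{Z}$ labels; $\mathsf{enab}(gcs)$ is the disjunction of guards; well formed: well typed and every $\mathsf{if}^n gcs\,\mathsf{fi}$ subcommand has $\mathsf{enab}(gcs)$ true in every store. $[\![c]\!]$: standard big-step partial-correctness relation (identity for skip, store update for assignment, composition, if picks any enabled branch, do iterates enabled branches until $\mathsf{enab}(gcs)$ is false). $\mathsf{lab}(c)$ is the label of $c$ ($\mathsf{lab}(c;d)=\mathsf{lab}(c)$), $\mathsf{labs}(c)$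 its labels, $\mathsf{ok}(c)$: labels positive and pairwise distinct; $\mathsf{sub}(n,c)$ the subcommand labelled $n$. $\mathsf{fsuc}$: $\mathsf{fsuc}(n,\mathsf{skip}^n,f)=\mathsf{fsuc}(n,x:=^ne,f)=\mathsf{fsuc}(n,\mathsf{if}^n\ldots,f)=\mathsf{fsuc}(n,\mathsf{do}^n\ldots,f)=f$; $\mathsf{fsuc}(n,c;d,f)=\mathsf{fsuc}(n,c,\mathsf{lab}(d))$ if $n\in\mathsf{labs}(c)$, else $\mathsf{fsuc}(n,d,f)$; for $m\in\mathsf{labs}(d)$ with $e\to d\in gcs$: $\mathsf{fsuc}(m,\mathsf{if}^n gcs\,\mathsf{fi},f)=\mathsf{fsuc}(m,d,f)$, $\mathsf{fsuc}(m,\mathsf{do}^n gcs\,\mathsf{od},f)=\mathsf{fsuc}(m,d,n)$. Small steps: $\langle\mathsf{if}^n gcs\,\mathsf{fi},s\rangle\to\langle d,s\rangle$ and $\langle\mathsf{do}^n gcs\,\mathsf{od},s\rangle\to\langle d;\mathsf{do}^n gcs\,\mathsf{od},s\rangle$ for $e\to d\in gcs$, $e$ true at $s$; $\langle\mathsf{do}^n gcs\,\mathsf{od},s\rangle\to\langle\mathsf{skip}^{ -n},s\rangle$ if $\mathsf{enab}(gcs)$ false; $\langle x:=^ne,s\rangle\to\langle\mathsf{skip}^{ -n},s[x\mapsto[\![e]\!](s)]\rangle$; $\langle\mathsf{skip}^n;c,s\rangle\to\langle c,s\rangle$; $\langle c;b,s\rangle\to\langle d;b,t\rangle$ if $\langle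 c,s\rangle\to\langle d,t\rangle$. $\mathsf{aut}(c,f)$: control points $\mathsf{labs}(c)\cup\{f\}$, initial $\mathsf{lab}(c)$, final $f$, $(n,s)\Rightarrow(m,t)$ iff $\langle\mathsf{sub}(n,c),s\rangle\to\langle d,t\rangle$ with ($\mathsf{lab}(d)>0$, $m=\mathsf{lab}(d)$) or ($\mathsf{lab}(d)<0$, $m=\mathsf{fsuc}(n,c,f)$), or $\mathsf{sub}(n,c)=\mathsf{skip}^n$, $m=\mathsf{fsuc}(n,c,f)$, $t=s$. $\models c:\{P\}\{Q\}$: $(s,t)\in[\![c]\!]$ and $s\in P$ imply $t\in Q$; $\models c\mid c':\langle\mathcal{Q}\rangle\langle\mathcal{S}\rangle$: $(s,t)\in[\![c]\!]$, $(s',t')\in[\![c']\!]$, $(s,s')\in\mathcal{Q}$ imply $(t,t')\in\mathcal{S}$. For an automaton with initial point $init$ and final $fin$, $B\models\{P\}\{Q\}$: $(init,s)\Rightarrow^*(fin,t)$ and $s\in P$ imply $t\in Q$; $B,B'\models\langle\mathcal{Q}\rangle\langle\mathcal{S}\rangle$: $(init,s)\Rightarrow^*(fin,t)$, $(init',s')\Rightarrow'^*(fin',t')$, $(s,s')\in\mathcal{Q}$ imply $(t,t')\in\mathcal{S}$. -}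

module Defs where

open import Data.Nat using (ℕ)
import Data.Nat as ℕ
open import Data.Integer using (ℤ; +_; -_; _<_)
import Data.Integer as ℤ
open import Data.Bool using (Bool; true; false; _∨_; if_then_else_)
open import Data.List using (List; []; _∷_; _++_)
open import Data.List.Relation.Unary.All using (All)
open import Data.List.Relation.Unary.Unique.Propositional using (Unique)
open import Data.List.Membership.DecPropositional ℤ._≟_ using (_∈?_)
open import Data.Maybe using (Maybe; just; nothing)
open import Data.Product using (_×_; _,_)
open import Relation.Nullary using (does)
open import Relation.Binary.PropositionalEquality using (_≡_)
open import Relation.Unary using (Pred)
open import Relation.Binary using (Rel)
open import Relation.Binary.Construct.Closure.ReflexiveTransitive using (Star)
open import Level using (0ℓ)
open import Data.Unit using (⊤)

Var : Set
Var = ℕ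

Store : Set
Store = Var → ℤ

_[_↦_] : Store → Var → ℤ → Store
(s [ x ↦ v ]) y = if does (y ℕ.≟ x) then v else s y

-- Expressions are given by their (well-typed) semantics:
-- integer expressions and boolean expressions (guards).
IExp : Set
IExp = Store → ℤ

BExp : Set
BExp = Store → Bool

mutual
  data Cmd : Set where
    skip   : ℤ → Cmd
    assign : ℤ → Var → IExp → Cmd
    _⨾_    : Cmd → Cmd → Cmd
    ifC    : ℤ → GCs → Cmd
    doC    : ℤ → GCs → Cmd

  data GCs : Set where
    gc1    : BExp → Cmd → GCs
    gcCons : BExp → Cmd → GCs → GCs

infixr 5 _⨾_

data InG : BExp → Cmd → GCs → Set where
  here1 : ∀ {e c} → InG e c (gc1 e c)
  hereC : ∀ {e c g} → InG e c (gcCons e c g)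
  there : ∀ {e c e' c' g} → InG e c g → InG e c (gcCons e' c' g)

enab : GCs → Store → Bool
enab (gc1 e c) s = e s
enab (gcCons e c g) s = e s ∨ enab g s

lab : Cmd → ℤ
lab (skip n) = n
lab (assign n x e) = n
lab (c ⨾ d) = lab c
lab (ifC n g) = n
lab (doC n g) = n

mutual
  labs : Cmd → List ℤ
  labs (skip n) = n ∷ []
  labs (assign n x e) = n ∷ []
  labs (c ⨾ d) = labs c ++ labs d
  labs (ifC n g) = n ∷ labsG g
  labs (doC n g) = n ∷ labsG g

  labsG : GCs → List ℤ
  labsG (gc1 e c) = labs c
  labsG (gcCons e c g) = labs c ++ labsG g

ok : Cmd → Set
ok c = All (λ n → + 0 < n) (labs c) × Unique (labs c)

-- well formed: (well typed, automatic here) and every if-subcommand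
-- has an enabled guard in every store
mutual
  WF : Cmd → Set
  WF (skip n) = ⊤
  WF (assign n x e) = ⊤
  WF (c ⨾ d) = WF c × WF d
  WF (ifC n g) = (∀ s → enab g s ≡ true) × WFG g
  WF (doC n g) = WFG g

  WFG : GCs → Set
  WFG (gc1 e c) = WF c
  WFG (gcCons e c g) = WF c × WFG g

mutual
  sub : ℤ → Cmd → Maybe Cmd
  sub n (skip k) = if does (n ℤ.≟ k) then just (skip k) else nothing
  sub n (assign k x e) = if does (n ℤ.≟ k) then just (assign k x e) else nothing
  sub n (c ⨾ d) = if does (n ∈? labs c) then sub n c else sub n d
  sub n (ifC k g) = if does (n ℤ.≟ k) then just (ifC k g) else subG n g
  sub n (doC k g) = if does (n ℤ.≟ k) then just (doC k g) else subG n g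

  subG : ℤ → GCs → Maybe Cmd
  subG n (gc1 e c) = sub n c
  subG n (gcCons e c g) = if does (n ∈? labs c) then sub n c else subG n g

mutual
  fsuc : ℤ → Cmd → ℤ → ℤ
  fsuc n (skip k) f = f
  fsuc n (assign k x e) f = f
  fsuc n (c ⨾ d) f = if does (n ∈? labs c) then fsuc n c (lab d) else fsuc n d f
  fsuc n (ifC k g) f = if does (n ℤ.≟ k) then f else fsucG n g f
  fsuc n (doC k g) f = if does (n ℤ.≟ k) then f else fsucG n g k

  fsucG : ℤ → GCs → ℤ → ℤ
  fsucG n (gc1 e c) f = fsuc n c f
  fsucG n (gcCons e c g) f = if does (n ∈? labs c) then fsuc n c f else fsucG n g f

data Big : Cmd → Store → Store → Set where
  skipB   : ∀ {n s} → Big (skip n) s s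
  assignB : ∀ {n x e s} → Big (assign n x e) s (s [ x ↦ e s ])
  seqB    : ∀ {c d s u t} → Big c s u → Big d u t → Big (c ⨾ d) s t
  ifB     : ∀ {n g e d s t} → InG e d g → e s ≡ true → Big d s t → Big (ifC n g) s t
  doStopB : ∀ {n g s} → enab g s ≡ false → Big (doC n g) s s
  doStepB : ∀ {n g e d s u t} → InG e d g → e s ≡ true → Big d s u →
            Big (doC n g) u t → Big (doC n g) s t

data Step : Cmd → Store → Cmd → Store → Set where
  ifS      : ∀ {n g e d s} → InG e d g → e s ≡ true → Step (ifC n g) s d s
  doS      : ∀ {n g e d s} → InG e d g → e s ≡ true →
             Step (doC n g) s (d ⨾ doC n g) s
  doExitS  : ∀ {n g s} → enab g s ≡ false → Step (doC n g) s (skip (- n)) s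
  assignS  : ∀ {n x e s} → Step (assign n x e) s (skip (- n)) (s [ x ↦ e s ])
  skipSeqS : ∀ {n c s} → Step (skip n ⨾ c) s c s
  seqS     : ∀ {c b d s t} → Step c s d t → Step (c ⨾ b) s (d ⨾ b) t

record Automaton : Set₁ where
  field
    points : List ℤ
    init   : ℤ
    fin    : ℤ
    _⇒_    : ℤ × Store → ℤ × Store → Set

data AStep (c : Cmd) (f : ℤ) : ℤ × Store → ℤ × Store → Set where
  stepPos  : ∀ {n s c₀ d t} → sub n c ≡ just c₀ → Step c₀ s d t →
             + 0 < lab d → AStep c f (n , s) (lab d , t)
  stepNeg  : ∀ {n s c₀ d t} → sub n c ≡ just c₀ → Step c₀ s d t →
             lab d < + 0 → AStep c f (n , s) (fsuc n c f , t)
  stepSkip : ∀ {n s} → sub n c ≡ just (skip n) →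
             AStep c f (n , s) (fsuc n c f , s)

aut : Cmd → ℤ → Automaton
aut c f = record
  { points = labs c ++ (f ∷ [])
  ; init   = lab c
  ; fin    = f
  ; _⇒_    = AStep c f
  }

Runs : Automaton → Store → Store → Set
Runs B s t = Star (Automaton._⇒_ B) (Automaton.init B , s) (Automaton.fin B , t)

HoareValid : Cmd → Pred Store 0ℓ → Pred Store 0ℓ → Set
HoareValid c P Q = ∀ s t → Big c s t → P s → Q t

AutValid : Automaton → Pred Store 0ℓ → Pred Store 0ℓ → Set
AutValid B P Q = ∀ s t → Runs B s t → P s → Q t

RelValid : Cmd → Cmd → Rel Store 0ℓ → Rel Store 0ℓ → Set
RelValid c c' R S = ∀ s t s' t' → Big c s t → Big c' s' t' → R s s' → S t t'

AutRelValid : Automaton → Automaton → Rel Store 0ℓ → Rel Store 0ℓ → Set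
AutRelValid B B' R S = ∀ s t s' t' → Runs B s t → Runs B' s' t' → R s s' → S t t'

{-# OPTIONS --safe #-}
module Submission where

-- On the labels of a subcommand d of c, the automaton aut(c, f) takes exactly the steps of
-- aut(d, k), where k is the point control reaches when d terminates: the head of the next
-- command of a sequence, the head of an enclosing loop, or f. Hence runs of aut(d, k) embed
-- into runs of aut(c, f), and, because labels are distinct, a run of aut(c, f) that enters d
-- stays among the labels of d until it first reaches k, where it can be cut. With these two
-- facts both directions are an induction on the command (respectively the big-step
-- derivation); a do-loop is cut at every return to its head.

open import Defs
open import Data.Integer using (ℤ)
open import Data.Product using (_×_; _,_)
open import Data.List.Membership.Propositional using (_∉_)
open import Function.Bundles using (_⇔_)
open import Relation.Unary using (Pred)
open import Relation.Binary using (Rel)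
open import Relation.Binary.Construct.Closure.ReflexiveTransitive using (Star)
open import Level using (0ℓ)

open import Data.Integer as ℤ using (+_; -_; _<_)
open import Data.Integer.Properties using (<-asym; neg-mono-<)
open import Data.Bool using (true; if_then_else_)
open import Data.Product using (∃; proj₁; proj₂)
open import Data.Sum using (_⊎_; inj₁; inj₂; [_,_]′; map₁)
open import Data.Empty using (⊥; ⊥-elim)
open import Data.Maybe using (just; nothing)
open import Data.List using (List; []; _∷_; _++_)
open import Data.List.Relation.Unary.All as All using (All; _∷_)
import Data.List.Relation.Unary.All.Properties as All
open import Data.List.Relation.Unary.AllPairs using ([]; _∷_)
open import Data.List.Relation.Unary.Unique.Propositional using (Unique)
open import Data.List.Relation.Unary.Unique.Propositional.Properties using (Unique[x∷xs]⇒x∉xs)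
open import Data.List.Relation.Unary.Any using (here; there)
open import Data.List.Relation.Binary.Disjoint.Propositional using (Disjoint)
open import Data.List.Relation.Binary.Subset.Propositional using (_⊆_)
open import Data.List.Relation.Binary.Subset.Propositional.Properties using (xs⊆xs++ys; xs⊆ys++xs)
open import Data.List.Membership.Propositional using (_∈_)
open import Data.List.Membership.DecPropositional ℤ._≟_ using (_∈?_)
open import Relation.Nullary using (does; yes; no)
open import Relation.Nullary.Decidable using (dec-true)
open import Relation.Binary.PropositionalEquality using (_≡_; refl; sym; trans; subst)
open import Relation.Binary.Construct.Closure.ReflexiveTransitive using (ε; _◅_; _◅◅_)
open import Function.Bundles using (mk⇔; Equivalence)

Unique-++⁻ˡ : ∀ {A : Set} {xs ys : List A} → Unique (xs ++ ys) → Unique xs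
Unique-++⁻ˡ {xs = []}     _        = []
Unique-++⁻ˡ {xs = x ∷ xs} (px ∷ u) = All.++⁻ˡ xs px ∷ Unique-++⁻ˡ u

Unique-++⁻ʳ : ∀ {A : Set} (xs : List A) {ys} → Unique (xs ++ ys) → Unique ys
Unique-++⁻ʳ []       u       = u
Unique-++⁻ʳ (x ∷ xs) (_ ∷ u) = Unique-++⁻ʳ xs u

Unique-++⇒Disjoint : ∀ {A : Set} {xs ys : List A} → Unique (xs ++ ys) → Disjoint xs ys
Unique-++⇒Disjoint {xs = x ∷ xs} (px ∷ u) (here refl , y∈) = All.lookup (All.++⁻ʳ xs px) y∈ refl
Unique-++⇒Disjoint {xs = x ∷ xs} (px ∷ u) (there x∈ , y∈) = Unique-++⇒Disjoint u (x∈ , y∈)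

PositiveDistinct : List ℤ → Set
PositiveDistinct xs = All (+ 0 <_) xs × Unique xs

PositiveDistinct-++⁻ˡ : ∀ {xs ys} → PositiveDistinct (xs ++ ys) → PositiveDistinct xs
PositiveDistinct-++⁻ˡ {xs} (p , u) = All.++⁻ˡ xs p , Unique-++⁻ˡ u

PositiveDistinct-++⁻ʳ : ∀ {xs ys} → PositiveDistinct (xs ++ ys) → PositiveDistinct ys
PositiveDistinct-++⁻ʳ {xs} (p , u) = All.++⁻ʳ xs p , Unique-++⁻ʳ xs u

PositiveDistinct-tail : ∀ {x xs} → PositiveDistinct (x ∷ xs) → PositiveDistinct xs
PositiveDistinct-tail (_ ∷ p , _ ∷ u) = p , u

neg-pos≮0 : ∀ {n} → + 0 < n → + 0 < - n → ⊥
neg-pos≮0 p = <-asym (neg-mono-< p)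

lab∈labs : ∀ c → lab c ∈ labs c
lab∈labs (skip n)       = here refl
lab∈labs (assign n x e) = here refl
lab∈labs (c ⨾ d)        = xs⊆xs++ys (labs c) (labs d) (lab∈labs c)
lab∈labs (ifC n g)      = here refl
lab∈labs (doC n g)      = here refl

InG-labs⊆ : ∀ {e d g} → InG e d g → labs d ⊆ labsG g
InG-labs⊆ here1                = λ m → m
InG-labs⊆ (hereC {g = g})      = xs⊆xs++ys _ (labsG g)
InG-labs⊆ (there {c' = c'} i) = λ m → xs⊆ys++xs _ (labs c') (InG-labs⊆ i m)

InG-ok : ∀ {e d g} → InG e d g → PositiveDistinct (labsG g) → ok d
InG-ok here1               o = o
InG-ok hereC               o = PositiveDistinct-++⁻ˡ o
InG-ok (there {c' = c'} i) o = InG-ok i (PositiveDistinct-++⁻ʳ {labs c'} o)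

if-≟-refl : ∀ {A : Set} n (x y : A) → (if does (n ℤ.≟ n) then x else y) ≡ x
if-≟-refl n x y rewrite dec-true (n ℤ.≟ n) refl = refl

sub-skip : ∀ n → sub n (skip n) ≡ just (skip n)
sub-skip n = if-≟-refl n _ nothing

sub-assign : ∀ n x e → sub n (assign n x e) ≡ just (assign n x e)
sub-assign n x e = if-≟-refl n _ nothing

sub-if : ∀ n g → sub n (ifC n g) ≡ just (ifC n g)
sub-if n g = if-≟-refl n _ (subG n g)

sub-do : ∀ n g → sub n (doC n g) ≡ just (doC n g)
sub-do n g = if-≟-refl n _ (subG n g)

fsuc-do : ∀ n g f → fsuc n (doC n g) f ≡ f
fsuc-do n g f = if-≟-refl n f (fsucG n g n)

mutual
  sub⇒∈labs : ∀ n c {c₀} → sub n c ≡ just c₀ → n ∈ labs c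
  sub⇒∈labs n (skip k) eq with n ℤ.≟ k
  sub⇒∈labs n (skip k) eq  | yes refl = here refl
  sub⇒∈labs n (skip k) ()  | no _
  sub⇒∈labs n (assign k x e) eq with n ℤ.≟ k
  sub⇒∈labs n (assign k x e) eq | yes refl = here refl
  sub⇒∈labs n (assign k x e) () | no _
  sub⇒∈labs n (c ⨾ d) eq with n ∈? labs c
  ... | yes n∈ = xs⊆xs++ys _ (labs d) n∈
  ... | no _   = xs⊆ys++xs _ (labs c) (sub⇒∈labs n d eq)
  sub⇒∈labs n (ifC k g) eq with n ℤ.≟ k
  ... | yes refl = here refl
  ... | no _     = there (subG⇒∈labsG n g eq)
  sub⇒∈labs n (doC k g) eq with n ℤ.≟ k
  ... | yes refl = here refl
  ... | no _     = there (subG⇒∈labsG n g eq)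

  subG⇒∈labsG : ∀ n g {c₀} → subG n g ≡ just c₀ → n ∈ labsG g
  subG⇒∈labsG n (gc1 e c) eq = sub⇒∈labs n c eq
  subG⇒∈labsG n (gcCons e c g) eq with n ∈? labs c
  ... | yes n∈ = xs⊆xs++ys _ (labsG g) n∈
  ... | no _   = xs⊆ys++xs _ (labs c) (subG⇒∈labsG n g eq)

mutual
  sub-labs⊆ : ∀ n c {c₀} → sub n c ≡ just c₀ → labs c₀ ⊆ labs c
  sub-labs⊆ n (skip k) eq with n ℤ.≟ k
  sub-labs⊆ n (skip k) refl | yes _ = λ m → m
  sub-labs⊆ n (skip k) ()   | no _
  sub-labs⊆ n (assign k x e) eq with n ℤ.≟ k
  sub-labs⊆ n (assign k x e) refl | yes _ = λ m → m
  sub-labs⊆ n (assign k x e) ()   | no _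
  sub-labs⊆ n (c ⨾ d) eq with n ∈? labs c
  ... | yes _ = λ m → xs⊆xs++ys _ (labs d) (sub-labs⊆ n c eq m)
  ... | no _  = λ m → xs⊆ys++xs _ (labs c) (sub-labs⊆ n d eq m)
  sub-labs⊆ n (ifC k g) eq with n ℤ.≟ k
  sub-labs⊆ n (ifC k g) refl | yes _ = λ m → m
  ... | no _ = λ m → there (subG-labs⊆ n g eq m)
  sub-labs⊆ n (doC k g) eq with n ℤ.≟ k
  sub-labs⊆ n (doC k g) refl | yes _ = λ m → m
  ... | no _ = λ m → there (subG-labs⊆ n g eq m)

  subG-labs⊆ : ∀ n g {c₀} → subG n g ≡ just c₀ → labs c₀ ⊆ labsG g
  subG-labs⊆ n (gc1 e c) eq = sub-labs⊆ n c eq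
  subG-labs⊆ n (gcCons e c g) eq with n ∈? labs c
  ... | yes _ = λ m → xs⊆xs++ys _ (labsG g) (sub-labs⊆ n c eq m)
  ... | no _  = λ m → xs⊆ys++xs _ (labs c) (subG-labs⊆ n g eq m)

mutual
  fsuc∈labs⊎exit : ∀ n c k → fsuc n c k ∈ labs c ⊎ fsuc n c k ≡ k
  fsuc∈labs⊎exit n (skip _)       k = inj₂ refl
  fsuc∈labs⊎exit n (assign _ _ _) k = inj₂ refl
  fsuc∈labs⊎exit n (c ⨾ d) k with n ∈? labs c
  ... | yes _ = inj₁ ([ xs⊆xs++ys _ (labs d) , (λ e → xs⊆ys++xs _ (labs c) (subst (_∈ labs d) (sym e) (lab∈labs d))) ]′
                        (fsuc∈labs⊎exit n c (lab d)))
  ... | no _  = map₁ (xs⊆ys++xs _ (labs c)) (fsuc∈labs⊎exit n d k)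
  fsuc∈labs⊎exit n (ifC k′ g) k with n ℤ.≟ k′
  ... | yes _ = inj₂ refl
  ... | no _  = map₁ there (fsucG∈labsG⊎exit n g k)
  fsuc∈labs⊎exit n (doC k′ g) k with n ℤ.≟ k′
  ... | yes _ = inj₂ refl
  ... | no _  = inj₁ ([ there , here ]′ (fsucG∈labsG⊎exit n g k′))

  fsucG∈labsG⊎exit : ∀ n g k → fsucG n g k ∈ labsG g ⊎ fsucG n g k ≡ k
  fsucG∈labsG⊎exit n (gc1 e c) k = fsuc∈labs⊎exit n c k
  fsucG∈labsG⊎exit n (gcCons e c g) k with n ∈? labs c
  ... | yes _ = map₁ (xs⊆xs++ys _ (labsG g)) (fsuc∈labs⊎exit n c k)
  ... | no _  = map₁ (xs⊆ys++xs _ (labs c)) (fsucG∈labsG⊎exit n g k)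

step-lab∈labs : ∀ {c s d t} → All (+ 0 <_) (labs c) → Step c s d t → + 0 < lab d → lab d ∈ labs c
step-lab∈labs _ (ifS {d = d} i _) _ = there (InG-labs⊆ i (lab∈labs d))
step-lab∈labs _ (doS {d = d} i _) _ = there (InG-labs⊆ i (lab∈labs d))
step-lab∈labs (n>0 ∷ _) (doExitS _) -n>0 = ⊥-elim (neg-pos≮0 n>0 -n>0)
step-lab∈labs (n>0 ∷ _) assignS     -n>0 = ⊥-elim (neg-pos≮0 n>0 -n>0)
step-lab∈labs _ (skipSeqS {c = c}) _ = there (lab∈labs c)
step-lab∈labs {c ⨾ b} pos (seqS st) p = xs⊆xs++ys _ (labs b) (step-lab∈labs (All.++⁻ˡ (labs c) pos) st p)

AStep-source : ∀ {c k n s x} → AStep c k (n , s) x → n ∈ labs c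
AStep-source {c} {n = n} (stepPos eq _ _) = sub⇒∈labs n c eq
AStep-source {c} {n = n} (stepNeg eq _ _) = sub⇒∈labs n c eq
AStep-source {c} {n = n} (stepSkip eq)    = sub⇒∈labs n c eq

AStep-target : ∀ {c k n s m t} → All (+ 0 <_) (labs c) → AStep c k (n , s) (m , t) → m ∈ labs c ⊎ m ≡ k
AStep-target {c} {n = n} pos (stepPos eq st p) =
  inj₁ (sub-labs⊆ n c eq (step-lab∈labs (All.anti-mono (sub-labs⊆ n c eq) pos) st p))
AStep-target {c} {k} {n} _ (stepNeg _ _ _) = fsuc∈labs⊎exit n c k
AStep-target {c} {k} {n} _ (stepSkip _)    = fsuc∈labs⊎exit n c k

run-from-exit : ∀ {c f u t} → f ∉ labs c → Star (AStep c f) (f , u) (f , t) → u ≡ t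
run-from-exit f∉ ε        = refl
run-from-exit f∉ (st ◅ _) = ⊥-elim (f∉ (AStep-source st))

AStep-transfer : ∀ {c k C F n s x} → sub n c ≡ sub n C → fsuc n c k ≡ fsuc n C F →
                 AStep c k (n , s) x → AStep C F (n , s) x
AStep-transfer eq₁ eq₂ (stepPos eq st p) = stepPos (trans (sym eq₁) eq) st p
AStep-transfer {C = C} {F} {n} eq₁ eq₂ (stepNeg {t = t} eq st p) =
  subst (λ m → AStep C F (n , _) (m , t)) (sym eq₂) (stepNeg (trans (sym eq₁) eq) st p)
AStep-transfer {C = C} {F} {n} {s} eq₁ eq₂ (stepSkip eq) =
  subst (λ m → AStep C F (n , s) (m , s)) (sym eq₂) (stepSkip (trans (sym eq₁) eq))

-- On the labels of c, aut(C, F) takes exactly the steps of aut(c, k).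
SubAutomaton : Cmd → ℤ → Cmd → ℤ → Set
SubAutomaton c k C F = ∀ {n} → n ∈ labs c → sub n C ≡ sub n c × fsuc n C F ≡ fsuc n c k

module _ {c k C F} (c⊑C : SubAutomaton c k C F) where

  embed-step : ∀ {n s x} → AStep c k (n , s) x → AStep C F (n , s) x
  embed-step st with c⊑C (AStep-source st)
  ... | eq₁ , eq₂ = AStep-transfer (sym eq₁) (sym eq₂) st

  restrict-step : ∀ {n s x} → n ∈ labs c → AStep C F (n , s) x → AStep c k (n , s) x
  restrict-step n∈ st with c⊑C n∈
  ... | eq₁ , eq₂ = AStep-transfer eq₁ eq₂ st

  embed-run : ∀ {p q} → Star (AStep c k) p q → Star (AStep C F) p q
  embed-run ε        = ε
  embed-run (st ◅ r) = embed-step st ◅ embed-run r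

  restrict-run : All (+ 0 <_) (labs c) → F ∉ labs c → ∀ {n s t} → n ∈ labs c →
                 Star (AStep C F) (n , s) (F , t) →
                 ∃ λ u → Star (AStep c k) (n , s) (k , u) × Star (AStep C F) (k , u) (F , t)
  restrict-run pos F∉ n∈ ε = ⊥-elim (F∉ n∈)
  restrict-run pos F∉ n∈ (_◅_ {j = m , s′} st r) with AStep-target pos (restrict-step n∈ st)
  ... | inj₂ refl = s′ , restrict-step n∈ st ◅ ε , r
  ... | inj₁ m∈ with restrict-run pos F∉ m∈ r
  ...   | u , r₁ , r₂ = u , restrict-step n∈ st ◅ r₁ , r₂

module _ {c C F} (c⊑C : SubAutomaton c F C F) where

  restrict-run-to-exit : All (+ 0 <_) (labs c) → F ∉ labs c → F ∉ labs C → ∀ {n s t} → n ∈ labs c →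
                         Star (AStep C F) (n , s) (F , t) → Star (AStep c F) (n , s) (F , t)
  restrict-run-to-exit pos F∉c F∉C n∈ r with restrict-run c⊑C pos F∉c n∈ r
  ... | u , r₁ , r₂ rewrite run-from-exit F∉C r₂ = r₁

⨾ˡ-sub : ∀ c d f → SubAutomaton c (lab d) (c ⨾ d) f
⨾ˡ-sub c d f {n} n∈ with n ∈? labs c
... | yes _ = refl , refl
... | no n∉ = ⊥-elim (n∉ n∈)

⨾ʳ-sub : ∀ c d f → Disjoint (labs c) (labs d) → SubAutomaton d f (c ⨾ d) f
⨾ʳ-sub c d f c#d {n} n∈ with n ∈? labs c
... | yes n∈c = ⊥-elim (c#d (n∈c , n∈))
... | no _    = refl , refl

branch-sub : ∀ {e d g n} → InG e d g → Unique (labsG g) → n ∈ labs d →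
             subG n g ≡ sub n d × (∀ k → fsucG n g k ≡ fsuc n d k)
branch-sub here1 _ _ = refl , λ _ → refl
branch-sub {d = d} {n = n} hereC _ n∈ with n ∈? labs d
... | yes _ = refl , λ _ → refl
... | no n∉ = ⊥-elim (n∉ n∈)
branch-sub {n = n} (there {c' = c'} i) u n∈ with n ∈? labs c'
... | yes n∈c′ = ⊥-elim (Unique-++⇒Disjoint u (n∈c′ , InG-labs⊆ i n∈))
... | no _     = branch-sub i (Unique-++⁻ʳ (labs c') u) n∈

if-branch-sub : ∀ {e d g k} f → InG e d g → Unique (k ∷ labsG g) → SubAutomaton d f (ifC k g) f
if-branch-sub {k = k} f i (k≢ ∷ u) {n} n∈ with n ℤ.≟ k | branch-sub i u n∈
... | yes refl | _          = ⊥-elim (All.lookup k≢ (InG-labs⊆ i n∈) refl)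
... | no _     | eq₁ , eq₂ = eq₁ , eq₂ f

do-body-sub : ∀ {e d g k} f → InG e d g → Unique (k ∷ labsG g) → SubAutomaton d k (doC k g) f
do-body-sub {k = k} f i (k≢ ∷ u) {n} n∈ with n ℤ.≟ k | branch-sub i u n∈
... | yes refl | _          = ⊥-elim (All.lookup k≢ (InG-labs⊆ i n∈) refl)
... | no _     | eq₁ , eq₂ = eq₁ , eq₂ k

InG-lab>0 : ∀ {e d g k} → InG e d g → All (+ 0 <_) (k ∷ labsG g) → + 0 < lab d
InG-lab>0 {d = d} i (_ ∷ pos) = All.lookup pos (InG-labs⊆ i (lab∈labs d))

InG-head∉ : ∀ {e d g k} → InG e d g → Unique (k ∷ labsG g) → k ∉ labs d
InG-head∉ i u k∈ = Unique[x∷xs]⇒x∉xs u (InG-labs⊆ i k∈)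

big⇒run : ∀ {c s t} → ok c → ∀ f → f ∉ labs c → Big c s t → Star (AStep c f) (lab c , s) (f , t)
big⇒run _ f _ (skipB {n}) = stepSkip (sub-skip n) ◅ ε
big⇒run (n>0 ∷ _ , _) f _ (assignB {n} {x} {e}) = stepNeg (sub-assign n x e) assignS (neg-mono-< n>0) ◅ ε
big⇒run o@(_ , u) f f∉ (seqB {c} {d} p q) =
  embed-run (⨾ˡ-sub c d f) (big⇒run (PositiveDistinct-++⁻ˡ o) (lab d) d∉c p)
  ◅◅ embed-run (⨾ʳ-sub c d f (Unique-++⇒Disjoint u)) (big⇒run (PositiveDistinct-++⁻ʳ {labs c} o) f f∉d q)
  where
  d∉c : lab d ∉ labs c
  d∉c d∈ = Unique-++⇒Disjoint u (d∈ , lab∈labs d)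
  f∉d : f ∉ labs d
  f∉d f∈ = f∉ (xs⊆ys++xs _ (labs c) f∈)
big⇒run o f f∉ (ifB {n = k} {g} i es p) =
  stepPos (sub-if k g) (ifS i es) (InG-lab>0 i (proj₁ o))
  ◅ embed-run (if-branch-sub f i (proj₂ o))
      (big⇒run (InG-ok i (PositiveDistinct-tail o)) f (λ f∈ → f∉ (there (InG-labs⊆ i f∈))) p)
big⇒run (k>0 ∷ _ , _) f _ (doStopB {n = k} {g} {s} en) =
  subst (λ m → Star (AStep (doC k g) f) (k , s) (m , s)) (fsuc-do k g f)
    (stepNeg (sub-do k g) (doExitS en) (neg-mono-< k>0) ◅ ε)
big⇒run o f f∉ (doStepB {n = k} {g} i es p q) =
  stepPos (sub-do k g) (doS i es) (InG-lab>0 i (proj₁ o))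
  ◅ embed-run (do-body-sub f i (proj₂ o)) (big⇒run (InG-ok i (PositiveDistinct-tail o)) k (InG-head∉ i (proj₂ o)) p)
  ◅◅ big⇒run o f f∉ q

data SelfStep (c : Cmd) (f n : ℤ) (s : Store) : ℤ × Store → Set where
  selfPos  : ∀ {d t} → Step c s d t → + 0 < lab d → SelfStep c f n s (lab d , t)
  selfNeg  : ∀ {d t} → Step c s d t → lab d < + 0 → SelfStep c f n s (fsuc n c f , t)
  selfSkip : c ≡ skip n → SelfStep c f n s (fsuc n c f , s)

self-step : ∀ {c f n s x} → sub n c ≡ just c → AStep c f (n , s) x → SelfStep c f n s x
self-step self (stepPos eq st p) with trans (sym self) eq
... | refl = selfPos st p
self-step self (stepNeg eq st p) with trans (sym self) eq
... | refl = selfNeg st p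
self-step self (stepSkip eq) with trans (sym self) eq
... | refl = selfSkip refl

RunsAreBig : Cmd → Set
RunsAreBig c = ∀ f → f ∉ labs c → ∀ {s t} → Star (AStep c f) (lab c , s) (f , t) → Big c s t

module DoLoop {k g} (o : ok (doC k g)) {f} (f∉ : f ∉ labs (doC k g))
              (branch-runs : ∀ {e d} → InG e d g → RunsAreBig d) where

  mutual
    loop-from-head : ∀ {s t} → Star (AStep (doC k g) f) (k , s) (f , t) → Big (doC k g) s t
    loop-from-head ε = ⊥-elim (f∉ (here refl))
    loop-from-head {s} (st ◅ r) with self-step (sub-do k g) st
    ... | selfPos (doS {d = d} i es) _ = loop-in-body i es (lab∈labs d) ε r
    ... | selfPos (doExitS _) -k>0     = ⊥-elim (neg-pos≮0 (All.head (proj₁ o)) -k>0)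
    ... | selfNeg (doS i _) d<0        = ⊥-elim (<-asym (InG-lab>0 i (proj₁ o)) d<0)
    ... | selfNeg (doExitS en) _       =
      subst (Big (doC k g) s) (run-from-exit f∉ (subst (λ m → Star (AStep (doC k g) f) (m , s) (f , _)) (fsuc-do k g f) r))
            (doStopB en)
    ... | selfSkip ()

    -- acc is the part of the current iteration of the body d executed so far.
    loop-in-body : ∀ {e d} → InG e d g → ∀ {s₀ m s₁ t} → e s₀ ≡ true → m ∈ labs d →
                   Star (AStep d k) (lab d , s₀) (m , s₁) → Star (AStep (doC k g) f) (m , s₁) (f , t) →
                   Big (doC k g) s₀ t
    loop-in-body i es m∈ acc ε = ⊥-elim (f∉ (there (InG-labs⊆ i m∈)))
    loop-in-body i es m∈ acc (st ◅ r) with restrict-step (do-body-sub f i (proj₂ o)) m∈ st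
    ... | st′ with AStep-target (proj₁ (InG-ok i (PositiveDistinct-tail o))) st′
    ...   | inj₁ m′∈  = loop-in-body i es m′∈ (acc ◅◅ st′ ◅ ε) r
    ...   | inj₂ refl = doStepB i es (branch-runs i k (InG-head∉ i (proj₂ o)) (acc ◅◅ st′ ◅ ε)) (loop-from-head r)

mutual
  run⇒big : ∀ c → ok c → RunsAreBig c
  run⇒big (skip n) _ f f∉ ε = ⊥-elim (f∉ (here refl))
  run⇒big (skip n) _ f f∉ {s} (st ◅ r) with self-step (sub-skip n) st
  ... | selfPos () _
  ... | selfNeg () _
  ... | selfSkip _ = subst (Big (skip n) s) (run-from-exit f∉ r) skipB
  run⇒big (assign n x e) _ f f∉ ε = ⊥-elim (f∉ (here refl))
  run⇒big (assign n x e) (n>0 ∷ _ , _) f f∉ (st ◅ r) with self-step (sub-assign n x e) st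
  ... | selfPos assignS -n>0    = ⊥-elim (neg-pos≮0 n>0 -n>0)
  ... | selfNeg (assignS {s = s}) _ = subst (Big (assign n x e) s) (run-from-exit f∉ r) assignB
  ... | selfSkip ()
  run⇒big (c ⨾ d) o@(_ , u) f f∉ r =
    let u₁ , r₁ , r₂ = restrict-run (⨾ˡ-sub c d f) (proj₁ oc) (λ f∈ → f∉ (xs⊆xs++ys _ (labs d) f∈)) (lab∈labs c) r
    in seqB (run⇒big c oc (lab d) d∉c r₁)
            (run⇒big d od f f∉d (restrict-run-to-exit (⨾ʳ-sub c d f c#d) (proj₁ od) f∉d f∉ (lab∈labs d) r₂))
    where
    oc : ok c
    oc = PositiveDistinct-++⁻ˡ o
    od : ok d
    od = PositiveDistinct-++⁻ʳ {labs c} o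
    c#d : Disjoint (labs c) (labs d)
    c#d = Unique-++⇒Disjoint u
    d∉c : lab d ∉ labs c
    d∉c d∈ = c#d (d∈ , lab∈labs d)
    f∉d : f ∉ labs d
    f∉d f∈ = f∉ (xs⊆ys++xs _ (labs c) f∈)
  run⇒big (ifC k g) o f f∉ ε = ⊥-elim (f∉ (here refl))
  run⇒big (ifC k g) o f f∉ (st ◅ r) with self-step (sub-if k g) st
  ... | selfPos (ifS {d = d} i es) _ =
    ifB i es (branch-runs⇒big g (PositiveDistinct-tail o) i f f∉d
               (restrict-run-to-exit (if-branch-sub f i (proj₂ o)) (proj₁ (InG-ok i (PositiveDistinct-tail o)))
                  f∉d f∉ (lab∈labs d) r))
    where
    f∉d : f ∉ labs d
    f∉d f∈ = f∉ (there (InG-labs⊆ i f∈))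
  ... | selfNeg (ifS i _) d<0 = ⊥-elim (<-asym (InG-lab>0 i (proj₁ o)) d<0)
  ... | selfSkip ()
  run⇒big (doC k g) o f f∉ r = DoLoop.loop-from-head o f∉ (branch-runs⇒big g (PositiveDistinct-tail o)) r

  branch-runs⇒big : ∀ g → PositiveDistinct (labsG g) → ∀ {e d} → InG e d g → RunsAreBig d
  branch-runs⇒big (gc1 e c) o here1 = run⇒big c o
  branch-runs⇒big (gcCons e c g) o hereC = run⇒big c (PositiveDistinct-++⁻ˡ o)
  branch-runs⇒big (gcCons e c g) o (there i) = branch-runs⇒big g (PositiveDistinct-++⁻ʳ {labs c} o) i

big⇔run : ∀ c → ok c → ∀ f → f ∉ labs c → ∀ s t → Big c s t ⇔ Runs (aut c f) s t
big⇔run c o f f∉ s t = mk⇔ (big⇒run o f f∉) (run⇒big c o f f∉)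

lemma3p22 : (c : Cmd) → WF c → ok c → (f : ℤ) → f ∉ labs c →
    ((s t : Store) → Big c s t ⇔ Star (AStep c f) (lab c , s) (f , t))
    × ((P Q : Pred Store 0ℓ) → HoareValid c P Q ⇔ AutValid (aut c f) P Q)
    × ((R S : Rel Store 0ℓ) → (c' : Cmd) → WF c' → ok c' → (f' : ℤ) → f' ∉ labs c' →
       RelValid c c' R S ⇔ AutRelValid (aut c f) (aut c' f') R S)
lemma3p22 c _ o f f∉ = big⇔run c o f f∉ , hoare , relational
  where
  open Equivalence using (to; from)

  hoare : (P Q : Pred Store 0ℓ) → HoareValid c P Q ⇔ AutValid (aut c f) P Q
  hoare P Q = mk⇔ (λ valid s t r → valid s t (from (big⇔run c o f f∉ s t) r))
                  (λ valid s t b → valid s t (to (big⇔run c o f f∉ s t) b))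

  relational : (R S : Rel Store 0ℓ) → (c′ : Cmd) → WF c′ → ok c′ → (f′ : ℤ) → f′ ∉ labs c′ →
               RelValid c c′ R S ⇔ AutRelValid (aut c f) (aut c′ f′) R S
  relational R S c′ _ o′ f′ f′∉ =
    mk⇔ (λ valid s t s′ t′ r r′ →
           valid s t s′ t′ (from (big⇔run c o f f∉ s t) r) (from (big⇔run c′ o′ f′ f′∉ s′ t′) r′))
        (λ valid s t s′ t′ b b′ →
           valid s t s′ t′ (to (big⇔run c o f f∉ s t) b) (to (big⇔run c′ o′ f′ f′∉ s′ t′) b′))
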